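{- Let $k$ be a positive integer and let $H$ be a triangle-free graph. Let $I_k \vee H$ denote the graph obtained from the disjoint union of an independent set $I_k$ of $k$ vertices and $H$ by adding all edges between $I_k$ and $V(H)$. Then \[ \nu(I_k \vee H) = \alpha'_k(H) \quad\text{and}\quad \tau(I_k \vee H) = k|V(H)| - \phi_k(H). \]
   Context: Graphs are finite and simple. For a graph $G$, $\tau(G)$ is the minimum size of an edge set $Y$ such that $G - Y$ is triangle-free, and $\nu(G)$ is the maximum size of a set of pairwise edge-disjoint triangles in $G$. $\alpha'_k(H)$ is the largest number of edges in a $k$-edge-colorable subgraph of $H$. A vertex set $D$ is $k$-dependent if $H[D]$ has maximum degree at most $k-1$; for $D \subseteq V(H)$, $\phi_k(D) = k|D| - |E(H[D])|$; and $\phi_k(H)$ denotes the maximum of $\phi_k(D)$ over all $k$-dependent sets $D \subseteq V(H)$. -}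

module Defs where

open import Data.Bool using (Bool; true; false; _∧_; not; if_then_else_)
open import Data.Nat using (ℕ; zero; suc; _+_; _*_; _∸_; _≤_; _<_)
open import Data.Fin using (Fin; splitAt; toℕ) renaming (zero to fz; suc to fs)
open import Data.Fin.Properties using () renaming (_<?_ to _<ᶠ?_)
open import Data.Sum using (_⊎_; inj₁; inj₂)
open import Data.Product using (Σ; ∃; _×_; _,_)
open import Data.List using (List; length)
open import Data.List.Relation.Unary.AllPairs using (AllPairs)
open import Data.Empty using (⊥)
open import Relation.Nullary using (¬_)
open import Relation.Nullary.Decidable using (⌊_⌋)
open import Relation.Binary.PropositionalEquality using (_≡_; _≢_; refl)

record Graph (n : ℕ) : Set where
  field
    adj   : Fin n → Fin n → Bool
    sym   : ∀ i j → adj i j ≡ adj j i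
    irrfl : ∀ i → adj i i ≡ false
open Graph public

Adj : ∀ {n} → Graph n → Fin n → Fin n → Set
Adj G i j = adj G i j ≡ true

count : ∀ {n} → (Fin n → Bool) → ℕ
count {zero}  f = 0
count {suc n} f = (if f fz then 1 else 0) + count (λ i → f (fs i))

sumFin : ∀ {n} → (Fin n → ℕ) → ℕ
sumFin {zero}  f = 0
sumFin {suc n} f = f fz + sumFin (λ i → f (fs i))

countPairs : ∀ {n} → (Fin n → Fin n → Bool) → ℕ
countPairs R = sumFin (λ i → count (λ j → R i j ∧ ⌊ i <ᶠ? j ⌋))

record EdgeSet {n} (G : Graph n) : Set where
  field
    mem   : Fin n → Fin n → Bool
    msym  : ∀ i j → mem i j ≡ mem j i
    msub  : ∀ i j → mem i j ≡ true → Adj G i j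
open EdgeSet public

∣_∣ₑ : ∀ {n} {G : Graph n} → EdgeSet G → ℕ
∣ Y ∣ₑ = countPairs (mem Y)

TriangleFree : ∀ {n} → Graph n → Set
TriangleFree G = ∀ a b c → Adj G a b → Adj G b c → Adj G a c → ⊥

_−ₑ_ : ∀ {n} (G : Graph n) → EdgeSet G → Graph n
adj   (G −ₑ Y) i j = adj G i j ∧ not (mem Y i j)
sym   (G −ₑ Y) i j rewrite sym G i j | msym Y i j = refl
irrfl (G −ₑ Y) i rewrite irrfl G i = refl

IsTau : ∀ {n} → Graph n → ℕ → Set
IsTau G t =
  (Σ (EdgeSet G) λ Y → ∣ Y ∣ₑ ≡ t × TriangleFree (G −ₑ Y))
  × (∀ (Y : EdgeSet G) → TriangleFree (G −ₑ Y) → t ≤ ∣ Y ∣ₑ)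

record Triangle {n} (G : Graph n) : Set where
  field
    va vb vc : Fin n
    ab : Adj G va vb
    bc : Adj G vb vc
    ac : Adj G va vc
open Triangle public

_∈ᵗ_ : ∀ {n} {G : Graph n} → Fin n → Triangle G → Set
v ∈ᵗ T = (v ≡ va T) ⊎ (v ≡ vb T) ⊎ (v ≡ vc T)

EdgeDisjoint : ∀ {n} {G : Graph n} → Triangle G → Triangle G → Set
EdgeDisjoint T S = ∀ u v → u ≢ v → u ∈ᵗ T → v ∈ᵗ T → u ∈ᵗ S → v ∈ᵗ S → ⊥

-- a set of pairwise edge-disjoint triangles (listed; pairwise
-- edge-disjointness forces the entries to be distinct)
Packing : ∀ {n} → Graph n → Set
Packing G = Σ (List (Triangle G)) (AllPairs EdgeDisjoint)

IsNu : ∀ {n} → Graph n → ℕ → Set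
IsNu G m =
  (Σ (Packing G) λ P → length (Data.Product.proj₁ P) ≡ m)
  × (∀ (P : Packing G) → length (Data.Product.proj₁ P) ≤ m)

record ColSub {n} (k : ℕ) (H : Graph n) : Set where
  field
    edges  : EdgeSet H
    colour : Fin n → Fin n → Fin k
    csym   : ∀ i j → mem edges i j ≡ true → colour i j ≡ colour j i
    proper : ∀ i j l → mem edges i j ≡ true → mem edges i l ≡ true →
             j ≢ l → colour i j ≢ colour i l
open ColSub public

IsAlpha' : ∀ {n} → ℕ → Graph n → ℕ → Set
IsAlpha' k H m =
  (Σ (ColSub k H) λ C → ∣ edges C ∣ₑ ≡ m)
  × (∀ (C : ColSub k H) → ∣ edges C ∣ₑ ≤ m)

VSet : ℕ → Set
VSet n = Fin n → Bool

degIn : ∀ {n} → Graph n → VSet n → Fin n → ℕ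
degIn H D v = count (λ u → D u ∧ adj H v u)

KDependent : ∀ {n} → ℕ → Graph n → VSet n → Set
KDependent k H D = ∀ v → D v ≡ true → degIn H D v < k

edgesIn : ∀ {n} → Graph n → VSet n → ℕ
edgesIn H D = countPairs (λ u v → D u ∧ D v ∧ adj H u v)

phi : ∀ {n} → ℕ → Graph n → VSet n → ℕ
phi k H D = k * count D ∸ edgesIn H D

IsPhi : ∀ {n} → ℕ → Graph n → ℕ → Set
IsPhi k H p =
  (Σ (VSet _) λ D → KDependent k H D × phi k H D ≡ p)
  × (∀ D → KDependent k H D → phi k H D ≤ p)

-- I_k ∨ H on vertex set Fin (k + n): the first k vertices form I_k

joinAdj : ∀ k {n} → Graph n → Fin (k + n) → Fin (k + n) → Bool
joinAdj k H i j with splitAt k i | splitAt k j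
... | inj₁ _ | inj₁ _ = false
... | inj₁ _ | inj₂ _ = true
... | inj₂ _ | inj₁ _ = true
... | inj₂ u | inj₂ v = adj H u v

joinSym : ∀ k {n} (H : Graph n) i j → joinAdj k H i j ≡ joinAdj k H j i
joinSym k H i j with splitAt k i | splitAt k j
... | inj₁ _ | inj₁ _ = refl
... | inj₁ _ | inj₂ _ = refl
... | inj₂ _ | inj₁ _ = refl
... | inj₂ u | inj₂ v = sym H u v

joinIrr : ∀ k {n} (H : Graph n) i → joinAdj k H i i ≡ false
joinIrr k H i with splitAt k i
... | inj₁ _ = refl
... | inj₂ u = irrfl H u

IkJoin : ∀ k {n} → Graph n → Graph (k + n)
adj   (IkJoin k H) = joinAdj k H
sym   (IkJoin k H) = joinSym k H
irrfl (IkJoin k H) = joinIrr k H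

-- Since I_k is independent and H is triangle-free, every triangle of I_k ∨ H is an apex i ∈ I_k
-- over an edge uv of H.
--
-- ν: the triangle (i, u, v) corresponds to the edge uv of H coloured i. Two such triangles share an
-- edge exactly when they have the same base, or the same colour at a common endpoint, so packings
-- and properly k-edge-coloured subgraphs of H correspond with equal sizes.
--
-- τ: for k-dependent D, deleting every edge from I_k to V(H) ∖ D together with E(H[D]) destroys all
-- triangles at cost k(n − |D|) + e(H[D]) = kn − φ_k(D). Conversely, let Y destroy all triangles and
-- let Dᵢ be the neighbourhood of the apex i in the remaining graph. Every edge of H[Dᵢ] lies in Y,
-- so averaging |Y| = Σᵢ (n − |Dᵢ|) + |Y ∩ E(H)| over the k apices gives an i with
-- |Y| ≥ k(n − |Dᵢ|) + e(H[Dᵢ]). Repeatedly deleting vertices of degree ≥ k from Dᵢ never decreases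
-- k|D| − e(H[D]) and ends in a k-dependent set, hence |Y| ≥ kn − φ_k(H).
module Submission where

open import Defs renaming (sym to adj-sym)
open import Data.Bool using (Bool; true; false; _∧_; _∨_; not; if_then_else_)
open import Data.Bool.Properties
  using (∧-zeroʳ; ∧-identityʳ; ∧-comm; ∨-comm; ∨-zeroʳ; ∧-conicalˡ; ∧-conicalʳ) renaming (_≟_ to _≟ᵇ_)
open import Data.Empty using (⊥; ⊥-elim)
import Data.Fin as Fin
open import Data.Fin using (Fin; _↑ˡ_; _↑ʳ_; splitAt; join) renaming (zero to fz; suc to fs)
open import Data.Fin.Properties
  using (_≟_; <-cmp; <-asym; <-irrefl; any?; all?; toℕ<n; toℕ-↑ˡ; toℕ-↑ʳ;
         ↑ˡ-injective; ↑ʳ-injective; splitAt-↑ˡ; splitAt-↑ʳ; join-splitAt)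
  renaming (_<?_ to _<ᶠ?_; suc-injective to fs-injective)
open import Data.List using (List; []; _∷_; _++_; map; filter; length; tabulate; allFin)
open import Data.List.Extrema.Nat using (argmax; argmax-all; f[xs]≤f[argmax])
open import Data.List.Membership.Propositional using (_∈_; mapWith∈)
open import Data.List.Membership.Propositional.Properties
  using (∈-++⁺ˡ; ∈-++⁺ʳ; ∈-map⁺; ∈-map⁻; ∈-++⁻; ∈-filter⁺; ∈-filter⁻; ∈-allFin)
open import Data.List.Membership.Setoid.Properties using (length-mapWith∈)
open import Data.List.Properties using (length-map; length-++)
open import Data.List.Relation.Unary.All as All using (All; []; _∷_)
open import Data.List.Relation.Unary.All.Properties using (all-filter)
open import Data.List.Relation.Unary.AllPairs as AllPairs using (AllPairs; []; _∷_)
import Data.List.Relation.Unary.AllPairs.Properties as AllPairs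
open import Data.List.Relation.Unary.Any using (here; there; _─_)
open import Data.List.Relation.Unary.Unique.Propositional using (Unique)
import Data.List.Relation.Unary.Unique.Propositional.Properties as Unique
open import Data.Nat
  using (ℕ; zero; suc; _+_; _*_; _∸_; _≤_; _<_; _≥_; z≤n; s≤s; _≤?_; _<?_; NonZero; >-nonZero)
open import Data.Nat.Properties hiding (_≟_; _<?_; <-cmp; <-asym; <-irrefl)
open import Algebra.Properties.CommutativeSemigroup +-commutativeSemigroup using (interchange; xy∙z≈xz∙y)
open import Data.Product using (Σ; ∃; _×_; _,_; _,′_; proj₁; proj₂; map₁)
open import Data.Sum using (_⊎_; inj₁; inj₂)
open import Data.Vec.Functional using () renaming (_∷_ to _∷ᵛ_)
open import Function using (_∘_)
open import Function.Bundles using (_⇔_; mk⇔; Equivalence)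
open import Relation.Binary.Definitions using (tri<; tri≈; tri>)
open import Relation.Binary.PropositionalEquality hiding (J)
open import Relation.Nullary using (Dec; yes; no; ¬_; contradiction)
open import Relation.Nullary.Decidable using (⌊_⌋; _×-dec_; _→-dec_)

indicator : Bool → ℕ
indicator b = if b then 1 else 0

count≡sumFin-indicator : ∀ {n} (f : Fin n → Bool) → count f ≡ sumFin (indicator ∘ f)
count≡sumFin-indicator {zero}  f = refl
count≡sumFin-indicator {suc n} f = cong (indicator (f fz) +_) (count≡sumFin-indicator (f ∘ fs))

sumFin-cong : ∀ {n} {f g : Fin n → ℕ} → (∀ i → f i ≡ g i) → sumFin f ≡ sumFin g
sumFin-cong {zero}  f≗g = refl
sumFin-cong {suc n} f≗g = cong₂ _+_ (f≗g fz) (sumFin-cong (f≗g ∘ fs))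

sumFin-mono-≤ : ∀ {n} {f g : Fin n → ℕ} → (∀ i → f i ≤ g i) → sumFin f ≤ sumFin g
sumFin-mono-≤ {zero}  f≤g = z≤n
sumFin-mono-≤ {suc n} f≤g = +-mono-≤ (f≤g fz) (sumFin-mono-≤ (f≤g ∘ fs))

sumFin-mono-< : ∀ {n} {f g : Fin (suc n) → ℕ} → (∀ i → f i < g i) → sumFin f < sumFin g
sumFin-mono-< f<g = +-mono-<-≤ (f<g fz) (sumFin-mono-≤ (<⇒≤ ∘ f<g ∘ fs))

sumFin-+ : ∀ {n} (f g : Fin n → ℕ) → sumFin (λ i → f i + g i) ≡ sumFin f + sumFin g
sumFin-+ {zero}  f g = refl
sumFin-+ {suc n} f g = begin
  (f fz + g fz) + sumFin (λ i → f (fs i) + g (fs i))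
    ≡⟨ cong ((f fz + g fz) +_) (sumFin-+ (f ∘ fs) (g ∘ fs)) ⟩
  (f fz + g fz) + (sumFin (f ∘ fs) + sumFin (g ∘ fs))
    ≡⟨ interchange (f fz) (g fz) _ _ ⟩
  (f fz + sumFin (f ∘ fs)) + (g fz + sumFin (g ∘ fs)) ∎
  where open ≡-Reasoning

sumFin-const : ∀ {n} c → sumFin {n} (λ _ → c) ≡ n * c
sumFin-const {zero}  c = refl
sumFin-const {suc n} c = cong (c +_) (sumFin-const {n} c)

sumFin-zero : ∀ {n} → sumFin {n} (λ _ → 0) ≡ 0
sumFin-zero {n} = trans (sumFin-const {n} 0) (*-zeroʳ n)

sumFin-*ˡ : ∀ {n} c (f : Fin n → ℕ) → sumFin (λ i → c * f i) ≡ c * sumFin f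
sumFin-*ˡ {zero}  c f = sym (*-zeroʳ c)
sumFin-*ˡ {suc n} c f =
  trans (cong (c * f fz +_) (sumFin-*ˡ c (f ∘ fs))) (sym (*-distribˡ-+ c (f fz) _))

sumFin-swap : ∀ {m n} (f : Fin m → Fin n → ℕ) →
  sumFin (λ i → sumFin (f i)) ≡ sumFin (λ j → sumFin (λ i → f i j))
sumFin-swap {zero}  {n} f = sym (sumFin-zero {n})
sumFin-swap {suc m} {n} f =
  trans (cong (sumFin (f fz) +_) (sumFin-swap (f ∘ fs)))
        (sym (sumFin-+ (f fz) (λ j → sumFin (λ i → f (fs i) j))))

sumFin-↑ : ∀ k {n} (f : Fin (k + n) → ℕ) →
  sumFin f ≡ sumFin (λ i → f (i ↑ˡ n)) + sumFin (λ v → f (k ↑ʳ v))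
sumFin-↑ zero    f = refl
sumFin-↑ (suc k) f = trans (cong (f fz +_) (sumFin-↑ k (f ∘ fs))) (sym (+-assoc (f fz) _ _))

sumFin-≤⇒∃≤ : ∀ {k} .{{_ : NonZero k}} (f g : Fin k → ℕ) →
  sumFin f ≤ sumFin g → ∃ λ i → f i ≤ g i
sumFin-≤⇒∃≤ {suc k} f g Σf≤Σg with any? (λ i → f i ≤? g i)
... | yes found = found
... | no  none  = contradiction Σf≤Σg (<⇒≱ (sumFin-mono-< (λ i → ≰⇒> (none ∘ (i ,_)))))

count-↑ : ∀ k {n} (f : Fin (k + n) → Bool) →
  count f ≡ count (λ i → f (i ↑ˡ n)) + count (λ v → f (k ↑ʳ v))
count-↑ zero    f = refl
count-↑ (suc k) f = trans (cong (indicator (f fz) +_) (count-↑ k (f ∘ fs))) (sym (+-assoc (indicator (f fz)) _ _))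

count-mono : ∀ {n} {f g : Fin n → Bool} → (∀ i → f i ≡ true → g i ≡ true) → count f ≤ count g
count-mono {zero}  f⇒g = z≤n
count-mono {suc n} {f} {g} f⇒g = +-mono-≤ (indicator-mono (f fz) (g fz) (f⇒g fz)) (count-mono (f⇒g ∘ fs))
  where
  indicator-mono : ∀ a b → (a ≡ true → b ≡ true) → indicator a ≤ indicator b
  indicator-mono false b _   = z≤n
  indicator-mono true  b a⇒b rewrite a⇒b refl = ≤-refl

count-cong : ∀ {n} {f g : Fin n → Bool} → (∀ i → f i ≡ g i) → count f ≡ count g
count-cong {zero}  f≗g = refl
count-cong {suc n} f≗g = cong₂ _+_ (cong indicator (f≗g fz)) (count-cong (f≗g ∘ fs))

count-false : ∀ {n} → count {n} (λ _ → false) ≡ 0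
count-false {zero}  = refl
count-false {suc n} = count-false {n}

count+count-not : ∀ {n} (f : Fin n → Bool) → count f + count (not ∘ f) ≡ n
count+count-not {zero}  f = refl
count+count-not {suc n} f with f fz
... | true  = cong suc (count+count-not (f ∘ fs))
... | false = trans (+-suc _ _) (cong suc (count+count-not (f ∘ fs)))

⌊⌋-true : ∀ {a} {A : Set a} (a? : Dec A) → A → ⌊ a? ⌋ ≡ true
⌊⌋-true (yes _) _ = refl
⌊⌋-true (no ¬a) a = contradiction a ¬a

⌊⌋-false : ∀ {a} {A : Set a} (a? : Dec A) → ¬ A → ⌊ a? ⌋ ≡ false
⌊⌋-false (yes a) ¬a = contradiction a ¬a
⌊⌋-false (no _)  _  = refl

⌊⌋-sound : ∀ {a} {A : Set a} (a? : Dec A) → ⌊ a? ⌋ ≡ true → A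
⌊⌋-sound (yes a) _ = a

∨-true : ∀ a {b} → a ∨ b ≡ true → a ≡ true ⊎ b ≡ true
∨-true true  _ = inj₁ refl
∨-true false b = inj₂ b

_==_ : ∀ {n} → Fin n → Fin n → Bool
fz   == fz   = true
fz   == fs _ = false
fs _ == fz   = false
fs i == fs j = i == j

==-refl : ∀ {n} (i : Fin n) → (i == i) ≡ true
==-refl fz     = refl
==-refl (fs i) = ==-refl i

==⇒≡ : ∀ {n} {i j : Fin n} → (i == j) ≡ true → i ≡ j
==⇒≡ {i = fz}   {fz}   _ = refl
==⇒≡ {i = fs i} {fs j} e = cong fs (==⇒≡ e)

sumFin-delta : ∀ {n} (w : Fin n) (h : Fin n → ℕ) → sumFin (λ u → if u == w then h u else 0) ≡ h w
sumFin-delta {suc n} fz     h = trans (cong (h fz +_) (sumFin-zero {n})) (+-identityʳ _)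
sumFin-delta {suc n} (fs w) h = sumFin-delta w (h ∘ fs)

_<ᵇ_ : ∀ {n} → Fin n → Fin n → Bool
i <ᵇ j = ⌊ i <ᶠ? j ⌋

indicator-<ᵇ : ∀ {n} {i j : Fin n} → i ≢ j → indicator (i <ᵇ j) + indicator (j <ᵇ i) ≡ 1
indicator-<ᵇ {i = i} {j} i≢j with <-cmp i j
... | tri< i<j _ _ rewrite ⌊⌋-true (i <ᶠ? j) i<j | ⌊⌋-false (j <ᶠ? i) (<-asym i<j) = refl
... | tri≈ _ i≡j _ = contradiction i≡j i≢j
... | tri> _ _ j<i rewrite ⌊⌋-false (i <ᶠ? j) (<-asym j<i) | ⌊⌋-true (j <ᶠ? i) j<i = refl

countPairs≤sumFin-count : ∀ {n} (R : Fin n → Fin n → Bool) → countPairs R ≤ sumFin (λ i → count (R i))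
countPairs≤sumFin-count R = sumFin-mono-≤ (λ i → count-mono (λ j → ∧-conicalˡ (R i j) _))

handshake : ∀ {n} (R : Fin n → Fin n → Bool) → (∀ i j → R i j ≡ R j i) → (∀ i → R i i ≡ false) →
  sumFin (λ i → count (R i)) ≡ countPairs R + countPairs R
handshake {n} R R-sym R-irrefl = begin
  sumFin (λ i → count (R i))
    ≡⟨ sumFin-cong (λ i → trans (count≡sumFin-indicator (R i)) (sumFin-cong (split i))) ⟩
  sumFin (λ i → sumFin (λ j → up i j + down i j))
    ≡⟨ trans (sumFin-cong (λ i → sumFin-+ (up i) (down i))) (sumFin-+ (sumFin ∘ up) (sumFin ∘ down)) ⟩
  sumFin (λ i → sumFin (up i)) + sumFin (λ i → sumFin (down i))
    ≡⟨ cong₂ _+_ (sumFin-cong (λ i → sym (count≡sumFin-indicator (λ j → R i j ∧ i <ᵇ j))))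
                 (trans (sumFin-swap down) (sumFin-cong (λ j → sym (down-transpose j)))) ⟩
  countPairs R + countPairs R ∎
  where
  open ≡-Reasoning
  up down : Fin n → Fin n → ℕ
  up   i j = indicator (R i j ∧ i <ᵇ j)
  down i j = indicator (R i j ∧ j <ᵇ i)
  split : ∀ i j → indicator (R i j) ≡ up i j + down i j
  split i j with i ≟ j
  ... | yes refl rewrite R-irrefl i = refl
  ... | no i≢j with R i j
  ...   | true  = sym (indicator-<ᵇ i≢j)
  ...   | false = refl
  down-transpose : ∀ j → count (λ i → R j i ∧ j <ᵇ i) ≡ sumFin (λ i → down i j)
  down-transpose j = trans (count≡sumFin-indicator (λ i → R j i ∧ j <ᵇ i))
    (sumFin-cong (λ i → cong (λ b → indicator (b ∧ j <ᵇ i)) (R-sym j i)))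

countPairs-mono : ∀ {n} {R S : Fin n → Fin n → Bool} →
  (∀ i j → R i j ≡ true → S i j ≡ true) → countPairs R ≤ countPairs S
countPairs-mono {R = R} {S} R⇒S = sumFin-mono-≤ (λ i → count-mono (λ j → ∧-mono (R⇒S i j)))
  where
  ∧-mono : ∀ {a b c} → (a ≡ true → b ≡ true) → a ∧ c ≡ true → b ∧ c ≡ true
  ∧-mono {true} a⇒b a∧c rewrite a⇒b refl = a∧c

countPairs-cong : ∀ {n} {R S : Fin n → Fin n → Bool} → (∀ i j → R i j ≡ S i j) → countPairs R ≡ countPairs S
countPairs-cong R≗S = sumFin-cong (λ i → count-cong (λ j → cong (_∧ _) (R≗S i j)))

module _ {A : Set} where

  length-─ : ∀ {x} (ys : List A) (x∈ys : x ∈ ys) → suc (length (ys ─ x∈ys)) ≡ length ys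
  length-─ (y ∷ ys) (here _)    = refl
  length-─ (y ∷ ys) (there x∈ys) = cong suc (length-─ ys x∈ys)

  ∈-─ : ∀ {x z} (ys : List A) (x∈ys : x ∈ ys) → z ∈ ys → z ≢ x → z ∈ (ys ─ x∈ys)
  ∈-─ (y ∷ ys) (here refl)  (here refl)  z≢x = contradiction refl z≢x
  ∈-─ (y ∷ ys) (here refl)  (there z∈ys) z≢x = z∈ys
  ∈-─ (y ∷ ys) (there x∈ys) (here refl)  z≢x = here refl
  ∈-─ (y ∷ ys) (there x∈ys) (there z∈ys) z≢x = there (∈-─ ys x∈ys z∈ys z≢x)

  Unique-⊆⇒length≤ : ∀ {xs ys : List A} → Unique xs → (∀ {x} → x ∈ xs → x ∈ ys) → length xs ≤ length ys
  Unique-⊆⇒length≤ {[]}     _              _  = z≤n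
  Unique-⊆⇒length≤ {x ∷ xs} {ys} (x∉xs ∷ xs!) xs⊆ys =
    subst (suc (length xs) ≤_) (length-─ ys x∈ys)
      (s≤s (Unique-⊆⇒length≤ xs! (λ z∈xs → ∈-─ ys x∈ys (xs⊆ys (there z∈xs)) (All.lookup x∉xs z∈xs ∘ sym))))
    where
    x∈ys : x ∈ ys
    x∈ys = xs⊆ys (here refl)

  AllPairs-∈ : ∀ {R : A → A → Set} {xs x y} → AllPairs R xs → x ∈ xs → y ∈ xs → x ≡ y ⊎ R x y ⊎ R y x
  AllPairs-∈ (Rx ∷ _)   (here refl) (here refl) = inj₁ refl
  AllPairs-∈ (Rx ∷ _)   (here refl) (there y∈)  = inj₂ (inj₁ (All.lookup Rx y∈))
  AllPairs-∈ (Rx ∷ _)   (there x∈)  (here refl) = inj₂ (inj₂ (All.lookup Rx x∈))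
  AllPairs-∈ (_  ∷ Rxs) (there x∈)  (there y∈)  = AllPairs-∈ Rxs x∈ y∈

  mapWith∈-AllPairs : ∀ {B : Set} {R : A → A → Set} {S : B → B → Set} (xs : List A) (f : ∀ {x} → x ∈ xs → B) →
    (∀ {x y} (x∈ : x ∈ xs) (y∈ : y ∈ xs) → R x y → S (f x∈) (f y∈)) → AllPairs R xs → AllPairs S (mapWith∈ xs f)
  mapWith∈-AllPairs []       f f-resp []          = []
  mapWith∈-AllPairs {R = R} {S} (x ∷ xs) f f-resp (Rx ∷ Rxs) =
    head xs there Rx ∷ mapWith∈-AllPairs xs (λ y∈ → f (there y∈)) (λ x∈ y∈ → f-resp (there x∈) (there y∈)) Rxs
    where
    head : ∀ ys (ι : ∀ {y} → y ∈ ys → y ∈ x ∷ xs) →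
      All (R x) ys → All (S (f (here refl))) (mapWith∈ ys (λ y∈ → f (ι y∈)))
    head []       ι []         = []
    head (y ∷ ys) ι (Rxy ∷ Rx) = f-resp (here refl) (ι (here refl)) Rxy ∷ head ys (λ y∈ → ι (there y∈)) Rx

length-filter-tabulate : ∀ {A : Set} {n} (g : Fin n → A) (h : A → Bool) →
  length (filter (λ x → h x ≟ᵇ true) (tabulate g)) ≡ count (h ∘ g)
length-filter-tabulate {n = zero}  g h = refl
length-filter-tabulate {n = suc n} g h with h (g fz)
... | true  = cong suc (length-filter-tabulate (g ∘ fs) h)
... | false = length-filter-tabulate (g ∘ fs) h

indicesWhere : ∀ {n} → (Fin n → Bool) → List (Fin n)
indicesWhere {n} f = filter (λ i → f i ≟ᵇ true) (allFin n)

pairsWhere : ∀ {m n} → (Fin m → Fin n → Bool) → List (Fin m × Fin n)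
pairsWhere {zero}  R = []
pairsWhere {suc m} R = map (fz ,′_) (indicesWhere (R fz)) ++ map (map₁ fs) (pairsWhere (R ∘ fs))

length-indicesWhere : ∀ {n} (f : Fin n → Bool) → length (indicesWhere f) ≡ count f
length-indicesWhere f = length-filter-tabulate (λ i → i) f

length-pairsWhere : ∀ {m n} (R : Fin m → Fin n → Bool) → length (pairsWhere R) ≡ sumFin (λ i → count (R i))
length-pairsWhere {zero}  R = refl
length-pairsWhere {suc m} R = begin
  length (map (fz ,′_) (indicesWhere (R fz)) ++ map (map₁ fs) (pairsWhere (R ∘ fs)))
    ≡⟨ length-++ (map (fz ,′_) (indicesWhere (R fz))) ⟩
  length (map (fz ,′_) (indicesWhere (R fz))) + length (map (map₁ fs) (pairsWhere (R ∘ fs)))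
    ≡⟨ cong₂ _+_ (trans (length-map (fz ,′_) (indicesWhere (R fz))) (length-indicesWhere (R fz)))
                 (trans (length-map (map₁ fs) (pairsWhere (R ∘ fs))) (length-pairsWhere (R ∘ fs))) ⟩
  count (R fz) + sumFin (λ i → count (R (fs i))) ∎
  where open ≡-Reasoning

pairsWhere-sound : ∀ {m n} (R : Fin m → Fin n → Bool) {i j} → (i , j) ∈ pairsWhere R → R i j ≡ true
pairsWhere-sound {suc m} R ij∈ with ∈-++⁻ (map (fz ,′_) (indicesWhere (R fz))) ij∈
... | inj₁ ij∈₀ with _ , j∈ , refl ← ∈-map⁻ (fz ,′_) ij∈₀ = proj₂ (∈-filter⁻ (λ j → R fz j ≟ᵇ true) {xs = allFin _} j∈)
... | inj₂ ij∈₊ with _ , ij∈′ , refl ← ∈-map⁻ (map₁ fs) ij∈₊ = pairsWhere-sound (R ∘ fs) ij∈′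

pairsWhere-complete : ∀ {m n} (R : Fin m → Fin n → Bool) {i j} → R i j ≡ true → (i , j) ∈ pairsWhere R
pairsWhere-complete {suc m} R {fz} {j} Rij =
  ∈-++⁺ˡ (∈-map⁺ (fz ,′_) (∈-filter⁺ (λ j → R fz j ≟ᵇ true) (∈-allFin j) Rij))
pairsWhere-complete {suc m} R {fs i} Rij =
  ∈-++⁺ʳ (map (fz ,′_) (indicesWhere (R fz))) (∈-map⁺ (map₁ fs) (pairsWhere-complete (R ∘ fs) Rij))

pairsWhere-unique : ∀ {m n} (R : Fin m → Fin n → Bool) → Unique (pairsWhere R)
pairsWhere-unique {zero}      R = []
pairsWhere-unique {suc m} {n} R = Unique.++⁺
  (Unique.map⁺ (cong proj₂) (Unique.filter⁺ (λ j → R fz j ≟ᵇ true) (Unique.allFin⁺ n)))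
  (Unique.map⁺ (λ e → cong₂ _,_ (fs-injective (cong proj₁ e)) (cong proj₂ e)) (pairsWhere-unique (R ∘ fs)))
  disjoint
  where
  disjoint : ∀ {p} → ¬ (p ∈ map (fz ,′_) (indicesWhere (R fz)) × p ∈ map (map₁ fs) (pairsWhere (R ∘ fs)))
  disjoint (p∈₀ , p∈₊) with _ , _ , refl ← ∈-map⁻ (fz ,′_) p∈₀ with _ , _ , () ← ∈-map⁻ (map₁ fs) p∈₊

module _ {A : Set} where

  _∈ᵉ_ : A → A × A → Set
  w ∈ᵉ (u , v) = w ≡ u ⊎ w ≡ v

  _≐_ : A × A → A × A → Set
  (u , v) ≐ (u' , v') = (u ≡ u' × v ≡ v') ⊎ (u ≡ v' × v ≡ u')

  ∈ᵉ⇒≐ : ∀ {w e} → w ∈ᵉ e → ∃ λ x → e ≐ (w , x)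
  ∈ᵉ⇒≐ {e = u , v} (inj₁ refl) = v , inj₁ (refl , refl)
  ∈ᵉ⇒≐ {e = u , v} (inj₂ refl) = u , inj₂ (refl , refl)

  ∈ᵉ-∈ᵉ⇒≐ : ∀ {w w' e} → w ≢ w' → w ∈ᵉ e → w' ∈ᵉ e → e ≐ (w , w')
  ∈ᵉ-∈ᵉ⇒≐ w≢w' (inj₁ refl) (inj₁ refl) = contradiction refl w≢w'
  ∈ᵉ-∈ᵉ⇒≐ w≢w' (inj₁ refl) (inj₂ refl) = inj₁ (refl , refl)
  ∈ᵉ-∈ᵉ⇒≐ w≢w' (inj₂ refl) (inj₁ refl) = inj₂ (refl , refl)
  ∈ᵉ-∈ᵉ⇒≐ w≢w' (inj₂ refl) (inj₂ refl) = contradiction refl w≢w'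

  ≐⇒∈ᵉ : ∀ {u v e} → (u , v) ≐ e → u ∈ᵉ e
  ≐⇒∈ᵉ (inj₁ (u≡ , _)) = inj₁ u≡
  ≐⇒∈ᵉ (inj₂ (u≡ , _)) = inj₂ u≡

  ≐-cancelˡ : ∀ {i j l e} → proj₁ e ≢ proj₂ e → (i , j) ≐ e → (i , l) ≐ e → j ≡ l
  ≐-cancelˡ _   (inj₁ (_ , refl))    (inj₁ (_ , refl))    = refl
  ≐-cancelˡ u≢v (inj₁ (refl , _))    (inj₂ (refl , _))    = contradiction refl u≢v
  ≐-cancelˡ u≢v (inj₂ (refl , _))    (inj₁ (refl , _))    = contradiction refl u≢v
  ≐-cancelˡ _   (inj₂ (_ , refl))    (inj₂ (_ , refl))    = refl

≐-sorted : ∀ {n} {u v u' v' : Fin n} {e} → (u , v) ≐ e → (u' , v') ≐ e → u Fin.< v → u' Fin.< v' →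
  (u , v) ≡ (u' , v')
≐-sorted (inj₁ (refl , refl)) (inj₁ (refl , refl)) _   _     = refl
≐-sorted (inj₁ (refl , refl)) (inj₂ (refl , refl)) u<v u'<v' = contradiction u<v (<-asym u'<v')
≐-sorted (inj₂ (refl , refl)) (inj₁ (refl , refl)) u<v u'<v' = contradiction u<v (<-asym u'<v')
≐-sorted (inj₂ (refl , refl)) (inj₂ (refl , refl)) _   _     = refl

_≐ᵇ_ : ∀ {n} → Fin n × Fin n → Fin n × Fin n → Bool
(u , v) ≐ᵇ (u' , v') = (u == u' ∧ v == v') ∨ (u == v' ∧ v == u')

≐ᵇ-sym : ∀ {n} (e e' : Fin n × Fin n) → e ≐ᵇ e' ≡ (proj₂ e , proj₁ e) ≐ᵇ e'
≐ᵇ-sym (u , v) (u' , v') =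
  trans (∨-comm (u == u' ∧ v == v') _) (cong₂ _∨_ (∧-comm (u == v') (v == u')) (∧-comm (u == u') (v == v')))

≐ᵇ⇒≐ : ∀ {n} {e e' : Fin n × Fin n} → e ≐ᵇ e' ≡ true → e ≐ e'
≐ᵇ⇒≐ {e = u , v} {u' , v'} e≐e' with ∨-true (u == u' ∧ v == v') e≐e'
... | inj₁ same    = inj₁ (==⇒≡ (∧-conicalˡ _ _ same) , ==⇒≡ (∧-conicalʳ (u == u') _ same))
... | inj₂ swapped = inj₂ (==⇒≡ (∧-conicalˡ _ _ swapped) , ==⇒≡ (∧-conicalʳ (u == v') _ swapped))

IsMinimum-by-offset : ∀ {A : Set} (P : A → Set) (size : A → ℕ) {p c} →
  (Σ A λ x → P x × size x + p ≡ c) → (∀ x → P x → c ≤ size x + p) →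
  ∀ t → ((Σ A λ x → size x ≡ t × P x) × (∀ x → P x → t ≤ size x)) ⇔ t + p ≡ c
IsMinimum-by-offset P size {p} (w , Pw , w+p≡c) c≤ t = mk⇔
  (λ ((x , x≡t , Px) , t≤) → ≤-antisym (≤-trans (+-monoˡ-≤ p (t≤ w Pw)) (≤-reflexive w+p≡c))
                                       (subst (λ s → _ ≤ s + p) x≡t (c≤ x Px)))
  (λ t+p≡c → (w , +-cancelʳ-≡ p _ _ (trans w+p≡c (sym t+p≡c)) , Pw)
           , λ x Px → +-cancelʳ-≤ p t _ (subst (_≤ size x + p) (sym t+p≡c) (c≤ x Px)))

IsMaximum : {A : Set} → (A → ℕ) → ℕ → Set
IsMaximum {A} size m = (Σ A λ x → size x ≡ m) × (∀ x → size x ≤ m)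

IsMaximum-transfer : ∀ {A B : Set} (sizeA : A → ℕ) (sizeB : B → ℕ) (f : A → B) (g : B → A) →
  (∀ a → sizeB (f a) ≡ sizeA a) → (∀ b → sizeB b ≤ sizeA (g b)) →
  ∀ m → IsMaximum sizeB m ⇔ IsMaximum sizeA m
IsMaximum-transfer sizeA sizeB f g f-size g-size m = mk⇔
  (λ ((b , b≡m) , ≤m) → (g b , ≤-antisym (≤ᴬ ≤m (g b)) (subst (_≤ _) b≡m (g-size b))) , ≤ᴬ ≤m)
  (λ ((a , a≡m) , ≤m) → (f a , trans (f-size a) a≡m) , λ b → ≤-trans (g-size b) (≤m (g b)))
  where
  ≤ᴬ : (∀ b → sizeB b ≤ m) → ∀ a → sizeA a ≤ m
  ≤ᴬ ≤m a = subst (_≤ m) (f-size a) (≤m (f a))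

-- Induced subgraphs and k-dependent sets

count-split : ∀ {n} (f : Fin n → Bool) (w : Fin n) →
  count f ≡ count (λ v → f v ∧ not (v == w)) + indicator (f w)
count-split {suc n} f fz rewrite ∧-zeroʳ (f fz) =
  trans (+-comm (indicator (f fz)) _) (cong (_+ indicator (f fz)) (count-cong (λ v → sym (∧-identityʳ (f (fs v))))))
count-split {suc n} f (fs w) rewrite ∧-identityʳ (f fz) =
  trans (cong (indicator (f fz) +_) (count-split (f ∘ fs) w)) (sym (+-assoc (indicator (f fz)) _ _))

_∖_ : ∀ {n} → VSet n → Fin n → VSet n
(D ∖ w) v = D v ∧ not (v == w)

count-∖ : ∀ {n} {D : VSet n} {w} → D w ≡ true → count D ≡ suc (count (D ∖ w))
count-∖ {D = D} {w} Dw = trans (count-split D w) (trans (cong (λ b → count (D ∖ w) + indicator b) Dw) (+-comm _ 1))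

double-injective : ∀ {a b} → a + a ≡ b + b → a ≡ b
double-injective {a} {b} e = *-cancelˡ-≡ a b 2
  (trans (cong (a +_) (+-identityʳ a)) (trans e (cong (b +_) (sym (+-identityʳ b)))))

module _ {n} (H : Graph n) where

  inducedAdj : VSet n → Fin n → Fin n → Bool
  inducedAdj D u v = D u ∧ D v ∧ adj H u v

  inducedAdj-sym : ∀ D u v → inducedAdj D u v ≡ inducedAdj D v u
  inducedAdj-sym D u v with D u | D v
  ... | true  | true  = adj-sym H u v
  ... | true  | false = refl
  ... | false | true  = refl
  ... | false | false = refl

  inducedAdj-irrefl : ∀ D u → inducedAdj D u u ≡ false
  inducedAdj-irrefl D u rewrite irrfl H u | ∧-zeroʳ (D u) = ∧-zeroʳ (D u)

  handshake-induced : ∀ D → sumFin (λ u → count (inducedAdj D u)) ≡ edgesIn H D + edgesIn H D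
  handshake-induced D = handshake (inducedAdj D) (inducedAdj-sym D) (inducedAdj-irrefl D)

  degIn≡count-inducedAdj : ∀ {D w} → D w ≡ true → degIn H D w ≡ count (inducedAdj D w)
  degIn≡count-inducedAdj {D} {w} Dw = count-cong (λ v → cong (λ b → b ∧ D v ∧ adj H w v) (sym Dw))

  count-inducedAdj-∖ : ∀ D w u → count (inducedAdj D u) ≡
    count (inducedAdj (D ∖ w) u) + (if u == w then count (inducedAdj D w) else 0) + indicator (inducedAdj D u w)
  count-inducedAdj-∖ D w u with u == w in u=w
  ... | true with refl ← ==⇒≡ {i = u} {w} u=w rewrite inducedAdj-irrefl D u | ==-refl u | ∧-zeroʳ (D u) =
    sym (trans (+-identityʳ _) (cong (_+ count (inducedAdj D u)) (count-false {n})))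
  ... | false rewrite ∧-identityʳ (D u) =
    trans (count-split (inducedAdj D u) w)
          (cong₂ _+_ (sym (trans (+-identityʳ _) (count-cong (λ v → reassoc (D u) (D v) (v == w) (adj H u v))))) refl)
    where
    reassoc : ∀ a b c d → a ∧ (b ∧ not c) ∧ d ≡ (a ∧ b ∧ d) ∧ not c
    reassoc false _     _ _ = refl
    reassoc true  false _ _ = refl
    reassoc true  true  c d = ∧-comm (not c) d

  edgesIn-∖ : ∀ {D w} → D w ≡ true → edgesIn H D ≡ edgesIn H (D ∖ w) + degIn H D w
  edgesIn-∖ {D} {w} Dw = double-injective (begin
    edgesIn H D + edgesIn H D                       ≡⟨ sym (handshake-induced D) ⟩
    sumFin (λ u → count (inducedAdj D u))            ≡⟨ sumFin-cong (count-inducedAdj-∖ D w) ⟩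
    sumFin (λ u → remaining u + at-w u + to-w u)     ≡⟨ sumFin-+ (λ u → remaining u + at-w u) to-w ⟩
    sumFin (λ u → remaining u + at-w u) + sumFin to-w ≡⟨ cong (_+ sumFin to-w) (sumFin-+ remaining at-w) ⟩
    sumFin remaining + sumFin at-w + sumFin to-w
      ≡⟨ cong₂ _+_ (cong₂ _+_ (handshake-induced (D ∖ w)) (sumFin-delta w (λ _ → deg))) column ⟩
    (e + e) + deg + deg
      ≡⟨ trans (+-assoc (e + e) deg deg) (interchange e e deg deg) ⟩
    (e + deg) + (e + deg)
      ≡⟨ cong (λ d → (e + d) + (e + d)) (sym (degIn≡count-inducedAdj Dw)) ⟩
    (e + degIn H D w) + (e + degIn H D w) ∎)
    where
    open ≡-Reasoning
    e deg : ℕ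
    e   = edgesIn H (D ∖ w)
    deg = count (inducedAdj D w)
    remaining at-w to-w : Fin n → ℕ
    remaining u = count (inducedAdj (D ∖ w) u)
    at-w      u = if u == w then deg else 0
    to-w      u = indicator (inducedAdj D u w)
    column : sumFin to-w ≡ deg
    column = sym (trans (count≡sumFin-indicator (inducedAdj D w))
                        (sumFin-cong (λ u → cong indicator (inducedAdj-sym D w u))))

module _ (k : ℕ) {n} (H : Graph n) where

  KDependent⇒edgesIn≤ : ∀ {D} → KDependent k H D → edgesIn H D ≤ k * count D
  KDependent⇒edgesIn≤ {D} kdep = begin
    edgesIn H D                            ≤⟨ countPairs≤sumFin-count (inducedAdj H D) ⟩
    sumFin (λ u → count (inducedAdj H D u)) ≤⟨ sumFin-mono-≤ degree-bound ⟩
    sumFin (λ u → k * indicator (D u))      ≡⟨ sumFin-*ˡ k (indicator ∘ D) ⟩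
    k * sumFin (indicator ∘ D)              ≡⟨ cong (k *_) (sym (count≡sumFin-indicator D)) ⟩
    k * count D                            ∎
    where
    open ≤-Reasoning
    degree-bound : ∀ u → count (inducedAdj H D u) ≤ k * indicator (D u)
    degree-bound u with D u in Du
    ... | true  = ≤-trans (<⇒≤ (kdep u Du)) (≤-reflexive (sym (*-identityʳ k)))
    ... | false = ≤-reflexive (trans (count-false {n}) (sym (*-zeroʳ k)))

  -- Deleting a vertex of degree at least k lowers k|D| by k and the edge count by at least k, so
  -- φ_k does not decrease. The inequality avoids truncated subtraction: φ_k is junk off k-dependent sets.
  Pruning : VSet n → Set
  Pruning D = Σ (VSet n) λ D' → KDependent k H D' × k * count D + edgesIn H D' ≤ k * count D' + edgesIn H D

  prune : ∀ D → Pruning D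
  prune D = prune-by (count D) D refl
    where
    heavy? : ∀ D v → Dec (D v ≡ true × k ≤ degIn H D v)
    heavy? D v = (D v ≟ᵇ true) ×-dec (k ≤? degIn H D v)

    absorb : ∀ c c' e e' d → k * c + e' ≤ k * c' + e → k ≤ d → k * suc c + e' ≤ k * c' + (e + d)
    absorb c c' e e' d ineq k≤d = begin
      k * suc c + e'    ≡⟨ trans (cong (_+ e') (*-suc k c)) (+-assoc k _ _) ⟩
      k + (k * c + e')  ≤⟨ +-mono-≤ k≤d ineq ⟩
      d + (k * c' + e)  ≡⟨ trans (+-comm d _) (+-assoc (k * c') e d) ⟩
      k * c' + (e + d)  ∎
      where open ≤-Reasoning

    prune-by : ∀ c D → count D ≡ c → Pruning D
    prune-by c D |D|≡c with any? {n} (heavy? D)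
    ... | no none = D , (λ v Dv → ≰⇒> (none ∘ (v ,_) ∘ (Dv ,_))) , ≤-refl
    prune-by zero D |D|≡0 | yes (w , Dw , _) = contradiction (trans (sym (count-∖ {D = D} Dw)) |D|≡0) λ ()
    prune-by (suc c) D |D|≡1+c | yes (w , Dw , k≤deg)
      with prune-by c (D ∖ w) (suc-injective (trans (sym (count-∖ {D = D} Dw)) |D|≡1+c))
    ... | D' , D'-kdep , ineq = D' , D'-kdep ,
      subst₂ (λ x y → k * x + edgesIn H D' ≤ k * count D' + y) (sym (count-∖ {D = D} Dw)) (sym (edgesIn-∖ H {D} Dw))
        (absorb _ _ _ _ _ ineq k≤deg)

allVSets : ∀ n → List (VSet n)
allVSets zero    = (λ ()) ∷ []
allVSets (suc n) = map (true ∷ᵛ_) (allVSets n) ++ map (false ∷ᵛ_) (allVSets n)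

∷ᵛ-∈-allVSets : ∀ {n} b {D : VSet n} → D ∈ allVSets n → (b ∷ᵛ D) ∈ allVSets (suc n)
∷ᵛ-∈-allVSets true  D∈ = ∈-++⁺ˡ (∈-map⁺ (true ∷ᵛ_) D∈)
∷ᵛ-∈-allVSets false D∈ = ∈-++⁺ʳ _ (∈-map⁺ (false ∷ᵛ_) D∈)

allVSets-complete : ∀ {n} (D : VSet n) → ∃ λ D' → D' ∈ allVSets n × (∀ v → D v ≡ D' v)
allVSets-complete {zero}  D = (λ ()) , here refl , λ ()
allVSets-complete {suc n} D with allVSets-complete (D ∘ fs)
... | D' , D'∈ , D≗D' = D fz ∷ᵛ D' , ∷ᵛ-∈-allVSets (D fz) D'∈ , λ { fz → refl ; (fs v) → D≗D' v }

module _ (k : ℕ) {n} (H : Graph n) where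

  module _ {D D' : VSet n} (D≗D' : ∀ v → D v ≡ D' v) where

    degIn-resp : ∀ v → degIn H D v ≡ degIn H D' v
    degIn-resp v = count-cong (λ u → cong (_∧ adj H v u) (D≗D' u))

    KDependent-resp : KDependent k H D → KDependent k H D'
    KDependent-resp kdep v D'v = subst (_< k) (degIn-resp v) (kdep v (trans (D≗D' v) D'v))

    phi-resp : phi k H D ≡ phi k H D'
    phi-resp = cong₂ (λ c e → k * c ∸ e) (count-cong D≗D')
      (countPairs-cong (λ u v → cong₂ (λ a b → a ∧ b ∧ adj H u v) (D≗D' u) (D≗D' v)))

  KDependent? : ∀ D → Dec (KDependent k H D)
  KDependent? D = all? (λ v → (D v ≟ᵇ true) →-dec (degIn H D v <? k))

  phi-maximum : ∃ (IsPhi k H)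
  phi-maximum = phi k H Dmax , (Dmax , Dmax-kdep , refl) , Dmax-max
    where
    ∅ : VSet n
    ∅ _ = false
    candidates : List (VSet n)
    candidates = filter KDependent? (allVSets n)
    Dmax : VSet n
    Dmax = argmax (phi k H) ∅ candidates
    Dmax-kdep : KDependent k H Dmax
    Dmax-kdep = argmax-all (phi k H) (λ _ ()) (all-filter KDependent? (allVSets n))
    Dmax-max : ∀ D → KDependent k H D → phi k H D ≤ phi k H Dmax
    Dmax-max D kdep with allVSets-complete D
    ... | D' , D'∈ , D≗D' = subst (_≤ phi k H Dmax) (sym (phi-resp D≗D'))
      (All.lookup (f[xs]≤f[argmax] ∅ candidates) (∈-filter⁺ KDependent? D'∈ (KDependent-resp D≗D' kdep)))

-- The join I_k ∨ H and its triangles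

data JoinView (k n : ℕ) : Fin (k + n) → Set where
  inI : (i : Fin k) → JoinView k n (i ↑ˡ n)
  inH : (v : Fin n) → JoinView k n (k ↑ʳ v)

joinView : ∀ k {n} (a : Fin (k + n)) → JoinView k n a
joinView k {n} a = subst (JoinView k n) (join-splitAt k n a) (view-join (splitAt k a))
  where
  view-join : (s : Fin k ⊎ Fin n) → JoinView k n (join k n s)
  view-join (inj₁ i) = inI i
  view-join (inj₂ v) = inH v

↑ˡ≢↑ʳ : ∀ k {n} (i : Fin k) (v : Fin n) → i ↑ˡ n ≢ k ↑ʳ v
↑ˡ≢↑ʳ k {n} i v eq with trans (sym (splitAt-↑ˡ k i n)) (trans (cong (splitAt k) eq) (splitAt-↑ʳ k n v))
... | ()

module _ (k : ℕ) {n : ℕ} where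

  ↑ˡ<ᵇ↑ʳ : ∀ (i : Fin k) (v : Fin n) → (i ↑ˡ n) <ᵇ (k ↑ʳ v) ≡ true
  ↑ˡ<ᵇ↑ʳ i v = ⌊⌋-true ((i ↑ˡ n) <ᶠ? (k ↑ʳ v))
    (subst₂ _<_ (sym (toℕ-↑ˡ i n)) (sym (toℕ-↑ʳ k v)) (≤-trans (toℕ<n i) (m≤m+n k _)))

  ↑ʳ<ᵇ↑ˡ : ∀ (v : Fin n) (i : Fin k) → (k ↑ʳ v) <ᵇ (i ↑ˡ n) ≡ false
  ↑ʳ<ᵇ↑ˡ v i = ⌊⌋-false ((k ↑ʳ v) <ᶠ? (i ↑ˡ n)) (<-asym (⌊⌋-sound ((i ↑ˡ n) <ᶠ? (k ↑ʳ v)) (↑ˡ<ᵇ↑ʳ i v)))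

  ↑ʳ<ᵇ↑ʳ : ∀ (u v : Fin n) → (k ↑ʳ u) <ᵇ (k ↑ʳ v) ≡ u <ᵇ v
  ↑ʳ<ᵇ↑ʳ u v with u <ᶠ? v
  ... | yes u<v = ⌊⌋-true ((k ↑ʳ u) <ᶠ? (k ↑ʳ v))
    (subst₂ _<_ (sym (toℕ-↑ʳ k u)) (sym (toℕ-↑ʳ k v)) (+-monoʳ-< k u<v))
  ... | no u≮v = ⌊⌋-false ((k ↑ʳ u) <ᶠ? (k ↑ʳ v))
    (u≮v ∘ +-cancelˡ-< k _ _ ∘ subst₂ _<_ (toℕ-↑ʳ k u) (toℕ-↑ʳ k v))

  countPairs-join : ∀ (R : Fin (k + n) → Fin (k + n) → Bool) → (∀ i j → R (i ↑ˡ n) (j ↑ˡ n) ≡ false) →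
    countPairs R ≡ sumFin (λ i → count (λ v → R (i ↑ˡ n) (k ↑ʳ v))) + countPairs (λ u v → R (k ↑ʳ u) (k ↑ʳ v))
  countPairs-join R R-II = trans (sumFin-↑ k _) (cong₂ _+_ (sumFin-cong row-I) (sumFin-cong row-H))
    where
    row-I : ∀ i → count (λ b → R (i ↑ˡ n) b ∧ (i ↑ˡ n) <ᵇ b) ≡ count (λ v → R (i ↑ˡ n) (k ↑ʳ v))
    row-I i = trans (count-↑ k _) (cong₂ _+_
      (trans (count-cong (λ j → cong (_∧ _) (R-II i j))) (count-false {k}))
      (count-cong (λ v → trans (cong (R (i ↑ˡ n) (k ↑ʳ v) ∧_) (↑ˡ<ᵇ↑ʳ i v)) (∧-identityʳ _))))
    row-H : ∀ u → count (λ b → R (k ↑ʳ u) b ∧ (k ↑ʳ u) <ᵇ b) ≡ count (λ v → R (k ↑ʳ u) (k ↑ʳ v) ∧ u <ᵇ v)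
    row-H u = trans (count-↑ k _) (cong₂ _+_
      (trans (count-cong (λ j → trans (cong (R (k ↑ʳ u) (j ↑ˡ n) ∧_) (↑ʳ<ᵇ↑ˡ u j)) (∧-zeroʳ _))) (count-false {k}))
      (count-cong (λ v → cong (R (k ↑ʳ u) (k ↑ʳ v) ∧_) (↑ʳ<ᵇ↑ʳ u v))))

module _ (k : ℕ) {n : ℕ} (H : Graph n) where

  joinAdj-↑ˡ↑ˡ : ∀ i j → joinAdj k H (i ↑ˡ n) (j ↑ˡ n) ≡ false
  joinAdj-↑ˡ↑ˡ i j rewrite splitAt-↑ˡ k i n | splitAt-↑ˡ k j n = refl

  joinAdj-↑ˡ↑ʳ : ∀ i v → joinAdj k H (i ↑ˡ n) (k ↑ʳ v) ≡ true
  joinAdj-↑ˡ↑ʳ i v rewrite splitAt-↑ˡ k i n | splitAt-↑ʳ k n v = refl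

  joinAdj-↑ʳ↑ʳ : ∀ u v → joinAdj k H (k ↑ʳ u) (k ↑ʳ v) ≡ adj H u v
  joinAdj-↑ʳ↑ʳ u v rewrite splitAt-↑ʳ k n u | splitAt-↑ʳ k n v = refl

OneOf : ∀ {m} → Fin m → Fin m → Fin m → Fin m → Set
OneOf x a b c = (x ≡ a) ⊎ (x ≡ b) ⊎ (x ≡ c)

_⊆ᵍ_ : ∀ {m} → Graph m → Graph m → Set
G ⊆ᵍ G' = ∀ a b → Adj G a b → Adj G' a b

adj-true⇒≢ : ∀ {m} (G : Graph m) {a b} → Adj G a b → a ≢ b
adj-true⇒≢ G {a} Gab refl with () ← trans (sym Gab) (irrfl G a)

module _ (k : ℕ) {n : ℕ} (H : Graph n) where

  record Cone (G : Graph (k + n)) (a b c : Fin (k + n)) : Set where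
    field
      apex          : Fin k
      base₁ base₂   : Fin n
      base₁<base₂   : base₁ Fin.< base₂
      apex∈         : OneOf (apex ↑ˡ n) a b c
      base₁∈        : OneOf (k ↑ʳ base₁) a b c
      base₂∈        : OneOf (k ↑ʳ base₂) a b c
      apex-base₁    : Adj G (apex ↑ˡ n) (k ↑ʳ base₁)
      apex-base₂    : Adj G (apex ↑ˡ n) (k ↑ʳ base₂)
      base₁-base₂   : Adj G (k ↑ʳ base₁) (k ↑ʳ base₂)

  module _ {G : Graph (k + n)} (G⊆J : G ⊆ᵍ IkJoin k H) where

    private
      G-sym : ∀ {a b} → Adj G a b → Adj G b a
      G-sym {a} {b} Gab = trans (adj-sym G b a) Gab

      G-H : ∀ {u v} → Adj G (k ↑ʳ u) (k ↑ʳ v) → Adj H u v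
      G-H {u} {v} Guv = trans (sym (joinAdj-↑ʳ↑ʳ k H u v)) (G⊆J _ _ Guv)

      no-II : ∀ {i j} → Adj G (i ↑ˡ n) (j ↑ˡ n) → ⊥
      no-II {i} {j} Gij with () ← trans (sym (G⊆J _ _ Gij)) (joinAdj-↑ˡ↑ˡ k H i j)

      cone : ∀ {a b c} i u v → OneOf (i ↑ˡ n) a b c → OneOf (k ↑ʳ u) a b c → OneOf (k ↑ʳ v) a b c →
        Adj G (i ↑ˡ n) (k ↑ʳ u) → Adj G (i ↑ˡ n) (k ↑ʳ v) → Adj G (k ↑ʳ u) (k ↑ʳ v) → Cone G a b c
      cone i u v i∈ u∈ v∈ iu iv uv with <-cmp u v
      ... | tri< u<v _ _ = record { apex = i ; base₁ = u ; base₂ = v ; base₁<base₂ = u<v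
        ; apex∈ = i∈ ; base₁∈ = u∈ ; base₂∈ = v∈ ; apex-base₁ = iu ; apex-base₂ = iv ; base₁-base₂ = uv }
      ... | tri≈ _ refl _ = contradiction refl (adj-true⇒≢ G uv)
      ... | tri> _ _ v<u = record { apex = i ; base₁ = v ; base₂ = u ; base₁<base₂ = v<u
        ; apex∈ = i∈ ; base₁∈ = v∈ ; base₂∈ = u∈ ; apex-base₁ = iv ; apex-base₂ = iu ; base₁-base₂ = G-sym uv }

    triangle⇒cone : TriangleFree H → ∀ a b c → Adj G a b → Adj G b c → Adj G a c → Cone G a b c
    triangle⇒cone tfH a b c ab bc ac with joinView k a | joinView k b | joinView k c
    ... | inI i | inI j | _     = ⊥-elim (no-II ab)
    ... | inI i | inH u | inI j = ⊥-elim (no-II ac)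
    ... | inH u | inI i | inI j = ⊥-elim (no-II bc)
    ... | inI i | inH u | inH v = cone i u v (inj₁ refl) (inj₂ (inj₁ refl)) (inj₂ (inj₂ refl)) ab ac bc
    ... | inH u | inI i | inH v = cone i u v (inj₂ (inj₁ refl)) (inj₁ refl) (inj₂ (inj₂ refl)) (G-sym ab) bc ac
    ... | inH u | inH v | inI i = cone i u v (inj₂ (inj₂ refl)) (inj₁ refl) (inj₂ (inj₁ refl)) (G-sym ac) (G-sym bc) ab
    ... | inH u | inH v | inH w = ⊥-elim (tfH u v w (G-H ab) (G-H bc) (G-H ac))

-- τ(I_k ∨ H)

module _ {m} {G : Graph m} (Y : EdgeSet G) where

  −ₑ-⊆ᵍ : (G −ₑ Y) ⊆ᵍ G
  −ₑ-⊆ᵍ a b = ∧-conicalˡ (adj G a b) _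

  −ₑ-∉ : ∀ {a b} → Adj (G −ₑ Y) a b → mem Y a b ≡ false
  −ₑ-∉ {a} {b} G-Yab with adj G a b | mem Y a b
  ... | true | false = refl

  −ₑ-∈ : ∀ {a b} → Adj G a b → mem Y a b ≡ false → Adj (G −ₑ Y) a b
  −ₑ-∈ Gab ab∉Y rewrite Gab | ab∉Y = refl

module _ (k : ℕ) {n : ℕ} (H : Graph n) where

  private
    J : Graph (k + n)
    J = IkJoin k H

  edgeSet-↑ˡ↑ˡ : (Y : EdgeSet J) → ∀ i j → mem Y (i ↑ˡ n) (j ↑ˡ n) ≡ false
  edgeSet-↑ˡ↑ˡ Y i j with mem Y (i ↑ˡ n) (j ↑ˡ n) in ij∈Y
  ... | false = refl
  ... | true with () ← trans (sym (msub Y _ _ ij∈Y)) (joinAdj-↑ˡ↑ˡ k H i j)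

  edgeSet-size-split : (Y : EdgeSet J) →
    ∣ Y ∣ₑ ≡ sumFin (λ i → count (λ v → mem Y (i ↑ˡ n) (k ↑ʳ v))) + countPairs (λ u v → mem Y (k ↑ʳ u) (k ↑ʳ v))
  edgeSet-size-split Y = countPairs-join k (mem Y) (edgeSet-↑ˡ↑ˡ Y)

  coverAdj : VSet n → Fin k ⊎ Fin n → Fin k ⊎ Fin n → Bool
  coverAdj D (inj₁ _) (inj₁ _) = false
  coverAdj D (inj₁ _) (inj₂ v) = not (D v)
  coverAdj D (inj₂ u) (inj₁ _) = not (D u)
  coverAdj D (inj₂ u) (inj₂ v) = inducedAdj H D u v

  cover : VSet n → EdgeSet J
  mem  (cover D) a b = coverAdj D (splitAt k a) (splitAt k b)
  msym (cover D) a b with splitAt k a | splitAt k b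
  ... | inj₁ _ | inj₁ _ = refl
  ... | inj₁ _ | inj₂ _ = refl
  ... | inj₂ _ | inj₁ _ = refl
  ... | inj₂ u | inj₂ v = inducedAdj-sym H D u v
  msub (cover D) a b ab∈Y with splitAt k a | splitAt k b
  ... | inj₁ _ | inj₂ _ = refl
  ... | inj₂ _ | inj₁ _ = refl
  ... | inj₂ u | inj₂ v with D u | D v
  ...   | true | true = ab∈Y

  cover-↑ˡ↑ʳ : ∀ D i v → mem (cover D) (i ↑ˡ n) (k ↑ʳ v) ≡ not (D v)
  cover-↑ˡ↑ʳ D i v rewrite splitAt-↑ˡ k i n | splitAt-↑ʳ k n v = refl

  cover-↑ʳ↑ʳ : ∀ D u v → mem (cover D) (k ↑ʳ u) (k ↑ʳ v) ≡ inducedAdj H D u v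
  cover-↑ʳ↑ʳ D u v rewrite splitAt-↑ʳ k n u | splitAt-↑ʳ k n v = refl

  cover-size : ∀ D → KDependent k H D → ∣ cover D ∣ₑ + phi k H D ≡ k * n
  cover-size D kdep = begin
    ∣ cover D ∣ₑ + (k * count D ∸ edgesIn H D)
      ≡⟨ cong (_+ (k * count D ∸ edgesIn H D)) (trans (edgeSet-size-split (cover D)) (cong₂ _+_
           (trans (sumFin-cong (λ i → count-cong (cover-↑ˡ↑ʳ D i))) (sumFin-const {k} (count (not ∘ D))))
           (countPairs-cong (cover-↑ʳ↑ʳ D)))) ⟩
    (k * count (not ∘ D) + edgesIn H D) + (k * count D ∸ edgesIn H D)
      ≡⟨ trans (+-assoc (k * count (not ∘ D)) _ _)
               (cong (k * count (not ∘ D) +_) (m+[n∸m]≡n (KDependent⇒edgesIn≤ k H kdep))) ⟩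
    k * count (not ∘ D) + k * count D
      ≡⟨ sym (*-distribˡ-+ k _ _) ⟩
    k * (count (not ∘ D) + count D)
      ≡⟨ cong (k *_) (trans (+-comm (count (not ∘ D)) (count D)) (count+count-not D)) ⟩
    k * n ∎
    where open ≡-Reasoning

  cover-triangleFree : TriangleFree H → ∀ D → TriangleFree (J −ₑ cover D)
  cover-triangleFree tfH D a b c ab bc ac = uv∉cover (−ₑ-∉ (cover D) base₁-base₂)
    where
    open Cone (triangle⇒cone k H {J −ₑ cover D} (−ₑ-⊆ᵍ (cover D)) tfH a b c ab bc ac)
    in-D : ∀ {i v} → Adj (J −ₑ cover D) (i ↑ˡ n) (k ↑ʳ v) → D v ≡ true
    in-D {i} {v} iv with D v | trans (sym (cover-↑ˡ↑ʳ D i v)) (−ₑ-∉ (cover D) iv)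
    ... | true | _ = refl
    uv∉cover : mem (cover D) (k ↑ʳ base₁) (k ↑ʳ base₂) ≡ false → ⊥
    uv∉cover uv∉ with () ← trans (sym uv∉) (trans (cover-↑ʳ↑ʳ D base₁ base₂)
      (trans (cong₂ (λ x y → x ∧ y ∧ adj H base₁ base₂) (in-D apex-base₁) (in-D apex-base₂))
             (trans (sym (joinAdj-↑ʳ↑ʳ k H base₁ base₂)) (−ₑ-⊆ᵍ (cover D) _ _ base₁-base₂))))

  module _ (Y : EdgeSet J) (tfY : TriangleFree (J −ₑ Y)) where

    -- the neighbourhood of apex i in J − Y
    link : Fin k → VSet n
    link i v = not (mem Y (i ↑ˡ n) (k ↑ʳ v))

    Y-in-H : Fin n → Fin n → Bool
    Y-in-H u v = mem Y (k ↑ʳ u) (k ↑ʳ v)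

    edgesIn-link≤ : ∀ i → edgesIn H (link i) ≤ countPairs Y-in-H
    edgesIn-link≤ i = countPairs-mono in-Y
      where
      in-Y : ∀ u v → inducedAdj H (link i) u v ≡ true → Y-in-H u v ≡ true
      in-Y u v uv∈link with Y-in-H u v in uv∈Y | mem Y (i ↑ˡ n) (k ↑ʳ u) in iu∈Y
                          | mem Y (i ↑ˡ n) (k ↑ʳ v) in iv∈Y | adj H u v in Huv
      ... | true  | _     | _     | _    = refl
      ... | false | false | false | true = ⊥-elim (tfY (i ↑ˡ n) (k ↑ʳ u) (k ↑ʳ v)
            (−ₑ-∈ Y (joinAdj-↑ˡ↑ʳ k H i u) iu∈Y)
            (−ₑ-∈ Y (trans (joinAdj-↑ʳ↑ʳ k H u v) Huv) uv∈Y)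
            (−ₑ-∈ Y (joinAdj-↑ˡ↑ʳ k H i v) iv∈Y))

    -- |Y| counts the n − |link i| deleted edges at each apex i plus the deleted edges of H.
    apex-sum : sumFin (λ i → k * count (link i) + ∣ Y ∣ₑ) ≡ sumFin {k} (λ _ → k * n + countPairs Y-in-H)
    apex-sum = begin
      sumFin (λ i → k * count (link i) + ∣ Y ∣ₑ)
        ≡⟨ trans (sumFin-+ (λ i → k * count (link i)) (λ _ → ∣ Y ∣ₑ))
                 (cong₂ _+_ (sumFin-*ˡ k (count ∘ link)) (sumFin-const {k} ∣ Y ∣ₑ)) ⟩
      k * sumFin (count ∘ link) + k * ∣ Y ∣ₑ
        ≡⟨ sym (*-distribˡ-+ k _ _) ⟩
      k * (sumFin (count ∘ link) + ∣ Y ∣ₑ)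
        ≡⟨ cong (λ y → k * (sumFin (count ∘ link) + y)) (edgeSet-size-split Y) ⟩
      k * (sumFin (count ∘ link) + (sumFin deleted + countPairs Y-in-H))
        ≡⟨ cong (k *_) (sym (+-assoc (sumFin (count ∘ link)) _ _)) ⟩
      k * ((sumFin (count ∘ link) + sumFin deleted) + countPairs Y-in-H)
        ≡⟨ cong (λ x → k * (x + countPairs Y-in-H))
             (trans (sym (sumFin-+ (count ∘ link) deleted)) (trans (sumFin-cong link+deleted) (sumFin-const {k} n))) ⟩
      k * (k * n + countPairs Y-in-H)
        ≡⟨ sym (sumFin-const {k} (k * n + countPairs Y-in-H)) ⟩
      sumFin {k} (λ _ → k * n + countPairs Y-in-H) ∎
      where
      open ≡-Reasoning
      deleted : Fin k → ℕ
      deleted i = count (λ v → mem Y (i ↑ˡ n) (k ↑ʳ v))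
      link+deleted : ∀ i → count (link i) + deleted i ≡ n
      link+deleted i = trans (+-comm (count (link i)) (deleted i)) (count+count-not (λ v → mem Y (i ↑ˡ n) (k ↑ʳ v)))

    tau-lower-bound : k ≥ 1 → ∀ {p} → IsPhi k H p → k * n ≤ ∣ Y ∣ₑ + p
    tau-lower-bound k≥1 {p} (_ , phi≤p)
      with sumFin-≤⇒∃≤ {{>-nonZero k≥1}} (λ _ → k * n + countPairs Y-in-H) (λ i → k * count (link i) + ∣ Y ∣ₑ)
                                          (≤-reflexive (sym apex-sum))
    ... | i , kn+f≤ with prune k H (link i)
    ... | D' , D'-kdep , pruned =
      ≤-trans (from-pruning (≤-trans (+-monoʳ-≤ (k * n) (edgesIn-link≤ i)) kn+f≤) pruned
                            (KDependent⇒edgesIn≤ k H D'-kdep))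
              (+-monoʳ-≤ ∣ Y ∣ₑ (phi≤p D' D'-kdep))
      where
      from-pruning : ∀ {a e c y e' c'} → a + e ≤ c + y → c + e' ≤ c' + e → e' ≤ c' → a ≤ y + (c' ∸ e')
      from-pruning {a} {e} {c} {y} {e'} {c'} h₁ h₂ e'≤c' =
        +-cancelʳ-≤ e' a _ (+-cancelʳ-≤ e (a + e') _ (begin
          (a + e') + e                ≡⟨ xy∙z≈xz∙y a e' e ⟩
          (a + e) + e'                ≤⟨ +-monoˡ-≤ e' h₁ ⟩
          (c + y) + e'                ≡⟨ xy∙z≈xz∙y c y e' ⟩
          (c + e') + y                ≤⟨ +-monoˡ-≤ y h₂ ⟩
          (c' + e) + y                ≡⟨ xy∙z≈xz∙y c' e y ⟩
          (c' + y) + e                ≡⟨ cong (λ x → (x + y) + e) (sym (m∸n+n≡m e'≤c')) ⟩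
          ((c' ∸ e') + e' + y) + e
            ≡⟨ cong (_+ e) (trans (xy∙z≈xz∙y (c' ∸ e') e' y) (cong (_+ e') (+-comm (c' ∸ e') y))) ⟩
          (y + (c' ∸ e') + e') + e     ∎))
        where open ≤-Reasoning

  tau-characterisation : TriangleFree H → k ≥ 1 → ∀ {p} → IsPhi k H p → ∀ t → IsTau J t ⇔ t + p ≡ k * n
  tau-characterisation tfH k≥1 phi@((D , D-kdep , φD≡p) , _) =
    IsMinimum-by-offset (λ Y → TriangleFree (J −ₑ Y)) ∣_∣ₑ
      (cover D , cover-triangleFree tfH D , trans (cong (∣ cover D ∣ₑ +_) (sym φD≡p)) (cover-size D D-kdep))
      (λ Y tfY → tau-lower-bound Y tfY k≥1 phi)

-- ν(I_k ∨ H)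

module _ (k : ℕ) {n} (H : Graph n) (C : ColSub k H) where

  private
    J : Graph (k + n)
    J = IkJoin k H
    E : EdgeSet H
    E = edges C

  sortedEdge : Fin n → Fin n → Bool
  sortedEdge u v = mem E u v ∧ u <ᵇ v

  sortedEdge⇒∈ : ∀ {u v} → sortedEdge u v ≡ true → mem E u v ≡ true
  sortedEdge⇒∈ {u} {v} = ∧-conicalˡ (mem E u v) _

  sortedEdge⇒< : ∀ {u v} → sortedEdge u v ≡ true → u Fin.< v
  sortedEdge⇒< {u} {v} = ⌊⌋-sound (u <ᶠ? v) ∘ ∧-conicalʳ (mem E u v) _

  colourTriangle : ∀ u v → sortedEdge u v ≡ true → Triangle J
  colourTriangle u v uv = record
    { va = colour C u v ↑ˡ n ; vb = k ↑ʳ u ; vc = k ↑ʳ v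
    ; ab = joinAdj-↑ˡ↑ʳ k H (colour C u v) u
    ; bc = trans (joinAdj-↑ʳ↑ʳ k H u v) (msub E u v (sortedEdge⇒∈ uv))
    ; ac = joinAdj-↑ˡ↑ʳ k H (colour C u v) v }

  module _ {u v} (uv : sortedEdge u v ≡ true) where

    ↑ˡ-∈-colourTriangle : ∀ {i} → (i ↑ˡ n) ∈ᵗ colourTriangle u v uv → i ≡ colour C u v
    ↑ˡ-∈-colourTriangle (inj₁ eq)        = ↑ˡ-injective n _ _ eq
    ↑ˡ-∈-colourTriangle (inj₂ (inj₁ eq)) = contradiction eq (↑ˡ≢↑ʳ k _ u)
    ↑ˡ-∈-colourTriangle (inj₂ (inj₂ eq)) = contradiction eq (↑ˡ≢↑ʳ k _ v)

    ↑ʳ-∈-colourTriangle : ∀ {w} → (k ↑ʳ w) ∈ᵗ colourTriangle u v uv → w ∈ᵉ (u , v)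
    ↑ʳ-∈-colourTriangle (inj₁ eq)        = contradiction (sym eq) (↑ˡ≢↑ʳ k _ _)
    ↑ʳ-∈-colourTriangle (inj₂ (inj₁ eq)) = inj₁ (↑ʳ-injective k _ _ eq)
    ↑ʳ-∈-colourTriangle (inj₂ (inj₂ eq)) = inj₂ (↑ʳ-injective k _ _ eq)

    ≐-edge : ∀ {w x} → (u , v) ≐ (w , x) → mem E w x ≡ true × colour C w x ≡ colour C u v
    ≐-edge (inj₁ (refl , refl)) = sortedEdge⇒∈ uv , refl
    ≐-edge (inj₂ (refl , refl)) = trans (msym E v u) (sortedEdge⇒∈ uv) , sym (csym C u v (sortedEdge⇒∈ uv))

  -- Two sorted edges through a common vertex w are distinct edges at w, so a proper colouring separates them.
  shared-endpoint⇒colour≢ : ∀ {u v u' v' w} (uv : sortedEdge u v ≡ true) (uv' : sortedEdge u' v' ≡ true) →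
    (u , v) ≢ (u' , v') → w ∈ᵉ (u , v) → w ∈ᵉ (u' , v') → colour C u v ≢ colour C u' v'
  shared-endpoint⇒colour≢ uv uv' uv≢uv' w∈ w∈' same with ∈ᵉ⇒≐ w∈ | ∈ᵉ⇒≐ w∈'
  ... | x , ≐wx | y , ≐wy with x ≟ y
  ...   | yes refl = uv≢uv' (≐-sorted ≐wx ≐wy (sortedEdge⇒< uv) (sortedEdge⇒< uv'))
  ...   | no  x≢y  = proper C _ x y (proj₁ (≐-edge uv ≐wx)) (proj₁ (≐-edge uv' ≐wy)) x≢y
                       (trans (proj₂ (≐-edge uv ≐wx)) (trans same (sym (proj₂ (≐-edge uv' ≐wy)))))

  colourTriangle-disjoint : ∀ {u v u' v'} (uv : sortedEdge u v ≡ true) (uv' : sortedEdge u' v' ≡ true) →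
    (u , v) ≢ (u' , v') → EdgeDisjoint (colourTriangle u v uv) (colourTriangle u' v' uv')
  colourTriangle-disjoint uv uv' uv≢uv' a b a≢b a∈ b∈ a∈' b∈' with joinView k a | joinView k b
  ... | inI i | inI j = a≢b (cong (_↑ˡ n) (trans (↑ˡ-∈-colourTriangle uv a∈) (sym (↑ˡ-∈-colourTriangle uv b∈))))
  ... | inI i | inH w = shared-endpoint⇒colour≢ uv uv' uv≢uv' (↑ʳ-∈-colourTriangle uv b∈) (↑ʳ-∈-colourTriangle uv' b∈')
                          (trans (sym (↑ˡ-∈-colourTriangle uv a∈)) (↑ˡ-∈-colourTriangle uv' a∈'))
  ... | inH w | inI i = shared-endpoint⇒colour≢ uv uv' uv≢uv' (↑ʳ-∈-colourTriangle uv a∈) (↑ʳ-∈-colourTriangle uv' a∈')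
                          (trans (sym (↑ˡ-∈-colourTriangle uv b∈)) (↑ˡ-∈-colourTriangle uv' b∈'))
  ... | inH w | inH w' = uv≢uv' (≐-sorted (∈ᵉ-∈ᵉ⇒≐ w≢w' (↑ʳ-∈-colourTriangle uv a∈) (↑ʳ-∈-colourTriangle uv b∈))
                                          (∈ᵉ-∈ᵉ⇒≐ w≢w' (↑ʳ-∈-colourTriangle uv' a∈') (↑ʳ-∈-colourTriangle uv' b∈'))
                                          (sortedEdge⇒< uv) (sortedEdge⇒< uv'))
    where
    w≢w' : w ≢ w'
    w≢w' = a≢b ∘ cong (k ↑ʳ_)

  colourPacking : Packing J
  colourPacking = mapWith∈ (pairsWhere sortedEdge) triangle ,
    mapWith∈-AllPairs (pairsWhere sortedEdge) triangle
      (λ p∈ p∈' → colourTriangle-disjoint (pairsWhere-sound sortedEdge p∈) (pairsWhere-sound sortedEdge p∈'))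
      (pairsWhere-unique sortedEdge)
    where
    triangle : ∀ {p} → p ∈ pairsWhere sortedEdge → Triangle J
    triangle {u , v} p∈ = colourTriangle u v (pairsWhere-sound sortedEdge p∈)

  length-colourPacking : length (proj₁ colourPacking) ≡ ∣ E ∣ₑ
  length-colourPacking = trans (length-mapWith∈ (setoid _) (pairsWhere sortedEdge)) (length-pairsWhere sortedEdge)

module _ (k : ℕ) {n} (H : Graph n) (tfH : TriangleFree H) where

  private
    J : Graph (k + n)
    J = IkJoin k H

  coneOf : (T : Triangle J) → Cone k H J (va T) (vb T) (vc T)
  coneOf T = triangle⇒cone k H (λ _ _ Jab → Jab) tfH (va T) (vb T) (vc T) (ab T) (bc T) (ac T)

  apexOf : Triangle J → Fin k
  apexOf T = Cone.apex (coneOf T)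

  baseOf : Triangle J → Fin n × Fin n
  baseOf T = Cone.base₁ (coneOf T) , Cone.base₂ (coneOf T)

  baseOf-sorted : ∀ T → proj₁ (baseOf T) Fin.< proj₂ (baseOf T)
  baseOf-sorted T = Cone.base₁<base₂ (coneOf T)

  ↑ʳ-∈ᵗ : ∀ {T w} → w ∈ᵉ baseOf T → (k ↑ʳ w) ∈ᵗ T
  ↑ʳ-∈ᵗ {T} (inj₁ refl) = Cone.base₁∈ (coneOf T)
  ↑ʳ-∈ᵗ {T} (inj₂ refl) = Cone.base₂∈ (coneOf T)

  EdgeDisjoint⇒baseOf≢ : ∀ {T S} → EdgeDisjoint T S → baseOf T ≢ baseOf S
  EdgeDisjoint⇒baseOf≢ {T} {S} T∥S same = T∥S _ _ (λ eq → <-irrefl (↑ʳ-injective k _ _ eq) (baseOf-sorted T))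
    (↑ʳ-∈ᵗ {T} (inj₁ refl)) (↑ʳ-∈ᵗ {T} (inj₂ refl))
    (↑ʳ-∈ᵗ {S} (inj₁ (cong proj₁ same))) (↑ʳ-∈ᵗ {S} (inj₂ (cong proj₂ same)))

  EdgeDisjoint⇒apex≢ : ∀ {T S w} → EdgeDisjoint T S → w ∈ᵉ baseOf T → w ∈ᵉ baseOf S → apexOf T ≢ apexOf S
  EdgeDisjoint⇒apex≢ {T} {S} T∥S w∈T w∈S same = T∥S _ _ (↑ˡ≢↑ʳ k _ _)
    (Cone.apex∈ (coneOf T)) (↑ʳ-∈ᵗ {T} w∈T)
    (subst (λ c → (c ↑ˡ n) ∈ᵗ S) (sym same) (Cone.apex∈ (coneOf S))) (↑ʳ-∈ᵗ {S} w∈S)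

  hasBase : Fin n → Fin n → Triangle J → Bool
  hasBase u v T = (u , v) ≐ᵇ baseOf T

  hasBase-baseOf : ∀ T → hasBase (proj₁ (baseOf T)) (proj₂ (baseOf T)) T ≡ true
  hasBase-baseOf T rewrite ==-refl (proj₁ (baseOf T)) | ==-refl (proj₂ (baseOf T)) = refl

  baseIn : List (Triangle J) → Fin n → Fin n → Bool
  baseIn []      u v = false
  baseIn (T ∷ L) u v = hasBase u v T ∨ baseIn L u v

  baseIn-sym : ∀ L u v → baseIn L u v ≡ baseIn L v u
  baseIn-sym []      u v = refl
  baseIn-sym (T ∷ L) u v = cong₂ _∨_ (≐ᵇ-sym (u , v) (baseOf T)) (baseIn-sym L u v)

  baseOf-baseIn : ∀ {T L} → T ∈ L → baseIn L (proj₁ (baseOf T)) (proj₂ (baseOf T)) ≡ true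
  baseOf-baseIn {T} (here refl) rewrite hasBase-baseOf T = refl
  baseOf-baseIn {T} {S ∷ L} (there T∈L) rewrite baseOf-baseIn T∈L = ∨-zeroʳ _

  -- c₀ is a junk colour for pairs that are not the base of any triangle of L.
  baseColour : Fin k → List (Triangle J) → Fin n → Fin n → Fin k
  baseColour c₀ []      u v = c₀
  baseColour c₀ (T ∷ L) u v = if hasBase u v T then apexOf T else baseColour c₀ L u v

  baseColour-sym : ∀ c₀ L u v → baseColour c₀ L u v ≡ baseColour c₀ L v u
  baseColour-sym c₀ []      u v = refl
  baseColour-sym c₀ (T ∷ L) u v rewrite ≐ᵇ-sym (u , v) (baseOf T) | baseColour-sym c₀ L u v = refl

  findBase : ∀ c₀ L {u v} → baseIn L u v ≡ true →
    Σ (Triangle J) λ T → T ∈ L × (u , v) ≐ baseOf T × baseColour c₀ L u v ≡ apexOf T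
  findBase c₀ (T ∷ L) {u} {v} uv with hasBase u v T in uv-base
  ... | true  = T , here refl , ≐ᵇ⇒≐ uv-base , refl
  ... | false with S , S∈L , uv≐ , colour≡ ← findBase c₀ L uv = S , there S∈L , uv≐ , colour≡

  ≐-baseOf⇒Adj : ∀ {u v} T → (u , v) ≐ baseOf T → Adj H u v
  ≐-baseOf⇒Adj T uv≐ with base-adj ← trans (sym (joinAdj-↑ʳ↑ʳ k H _ _)) (Cone.base₁-base₂ (coneOf T)) | uv≐
  ... | inj₁ (refl , refl) = base-adj
  ... | inj₂ (refl , refl) = trans (adj-sym H _ _) base-adj

  baseIn⇒Adj : ∀ L u v → baseIn L u v ≡ true → Adj H u v
  baseIn⇒Adj (T ∷ L) u v uv with ∨-true (hasBase u v T) uv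
  ... | inj₁ uv-base = ≐-baseOf⇒Adj T (≐ᵇ⇒≐ uv-base)
  ... | inj₂ uv∈L    = baseIn⇒Adj L u v uv∈L

  packingColouring : Fin k → Packing J → ColSub k H
  packingColouring c₀ (L , L∥) = record
    { edges  = record { mem = baseIn L ; msym = baseIn-sym L ; msub = baseIn⇒Adj L }
    ; colour = baseColour c₀ L
    ; csym   = λ u v _ → baseColour-sym c₀ L u v
    ; proper = proper-baseColour }
    where
    proper-baseColour : ∀ i j l → baseIn L i j ≡ true → baseIn L i l ≡ true → j ≢ l →
      baseColour c₀ L i j ≢ baseColour c₀ L i l
    proper-baseColour i j l ij il j≢l same
      with T , T∈ , ij≐ , colour≡T ← findBase c₀ L ij | S , S∈ , il≐ , colour≡S ← findBase c₀ L il
      with AllPairs-∈ L∥ T∈ S∈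
    ... | inj₁ refl = j≢l (≐-cancelˡ (λ eq → <-irrefl eq (baseOf-sorted T)) ij≐ il≐)
    ... | inj₂ (inj₁ T∥S) =
      EdgeDisjoint⇒apex≢ T∥S (≐⇒∈ᵉ ij≐) (≐⇒∈ᵉ il≐) (trans (sym colour≡T) (trans same colour≡S))
    ... | inj₂ (inj₂ S∥T) =
      EdgeDisjoint⇒apex≢ S∥T (≐⇒∈ᵉ il≐) (≐⇒∈ᵉ ij≐) (trans (sym colour≡S) (trans (sym same) colour≡T))

  length≤packingColouring : ∀ c₀ P → length (proj₁ P) ≤ ∣ edges (packingColouring c₀ P) ∣ₑ
  length≤packingColouring c₀ (L , L∥) = begin
    length L                                        ≡⟨ sym (length-map baseOf L) ⟩
    length (map baseOf L)                           ≤⟨ Unique-⊆⇒length≤ bases-unique bases⊆ ⟩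
    length (pairsWhere (λ u v → baseIn L u v ∧ u <ᵇ v)) ≡⟨ length-pairsWhere (λ u v → baseIn L u v ∧ u <ᵇ v) ⟩
    countPairs (baseIn L)                           ∎
    where
    open ≤-Reasoning
    bases-unique : Unique (map baseOf L)
    bases-unique = AllPairs.map⁺ (AllPairs.map EdgeDisjoint⇒baseOf≢ L∥)
    bases⊆ : ∀ {p} → p ∈ map baseOf L → p ∈ pairsWhere (λ u v → baseIn L u v ∧ u <ᵇ v)
    bases⊆ p∈ with T , T∈ , refl ← ∈-map⁻ baseOf p∈ =
      pairsWhere-complete _ (trans (cong (_∧ _) (baseOf-baseIn T∈)) (⌊⌋-true (_ <ᶠ? _) (baseOf-sorted T)))

theorem1p7 : (k : ℕ) → k ≥ 1 → (n : ℕ) → (H : Graph n) → TriangleFree H →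
    (∀ m → IsNu (IkJoin k H) m ⇔ IsAlpha' k H m)
    × (∀ t → IsTau (IkJoin k H) t ⇔ Σ ℕ (λ p → IsPhi k H p × t + p ≡ k * n))
theorem1p7 k k≥1 n H tfH = nu , tau
  where
  c₀ : Fin k
  c₀ = Fin.fromℕ< k≥1

  nu : ∀ m → IsNu (IkJoin k H) m ⇔ IsAlpha' k H m
  nu = IsMaximum-transfer (λ C → ∣ edges C ∣ₑ) (length ∘ proj₁) (colourPacking k H) (packingColouring k H tfH c₀)
         (length-colourPacking k H) (length≤packingColouring k H tfH c₀)

  tau : ∀ t → IsTau (IkJoin k H) t ⇔ Σ ℕ (λ p → IsPhi k H p × t + p ≡ k * n)
  tau t with p , isPhi ← phi-maximum k H = mk⇔
    (λ isTau → p , isPhi , Equivalence.to (tau-characterisation k H tfH k≥1 isPhi t) isTau)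
    (λ (p' , isPhi' , t+p'≡kn) → Equivalence.from (tau-characterisation k H tfH k≥1 isPhi' t) t+p'≡kn)
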